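{- Let $\mathbf{k}$ be a commutative ring, let $\beta,\alpha\in\mathbf{k}$, and let $n$ be a positive integer. Let $\mathcal{X}=\mathbf{k}[x_{i,j}\mid 1\le i<j\le n]$ and let $\mathcal{J}\subseteq\mathcal{X}$ be the ideal generated by all elements $x_{i,j}x_{j,k}-x_{i,k}(x_{i,j}+x_{j,k}+\beta)-\alpha$ with $1\le i<j<k\le n$. For $1\le j<i\le n$ define $x_{i,j}=-\beta-x_{j,i}\in\mathcal{X}$. Let $S_n$ be the symmetric group of $\{1,\dots,n\}$. Then: (a) there is a unique action of $S_n$ on $\mathcal{X}$ by $\mathbf{k}$-algebra automorphisms such that $\sigma\cdot x_{i,j}=x_{\sigma(i),\sigma(j)}$ for all $\sigma\in S_n$ and all pairs $(i,j)$ of distinct elements of $\{1,\dots,n\}$; (b) the ideal $\mathcal{J}$ is invariant under this action, so the quotient $\mathbf{k}$-algebra $\mathcal{X}/\mathcal{J}$ inherits an $S_n$-action. -}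

module Defs where

open import Level using (Level; _⊔_)
open import Algebra.Bundles using (CommutativeRing)
open import Data.Nat using (ℕ)
open import Data.Fin using (Fin; _<_)
open import Data.Fin.Properties using (<-cmp)
open import Data.Fin.Permutation using (Permutation′; _⟨$⟩ʳ_; id; _∘ₚ_)
open import Relation.Binary.Definitions using (tri<; tri≈; tri>)
open import Relation.Binary.PropositionalEquality using (_≢_)

-- The polynomial ring  X = k[x_{i,j} | 1 ≤ i < j ≤ n]  realised as the free
-- commutative k-algebra on the variables x_{i,j} (i < j): syntactic
-- expressions modulo the least congruence containing the commutative-ring
-- axioms and making  con : k → X  a ring homomorphism.
-- Indices 1..n are represented by Fin n (0..n-1).
module Poly {c ℓ : Level} (R : CommutativeRing c ℓ) (n : ℕ) where
  open CommutativeRing R using (0#; 1#; _+_; _*_; -_) renaming (Carrier to K; _≈_ to _≈K_)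

  record Var : Set where
    constructor v
    field
      i j : Fin n
      i<j : i < j

  data Expr : Set c where
    con  : K → Expr
    var  : Var → Expr
    _⊕_  : Expr → Expr → Expr
    _⊗_  : Expr → Expr → Expr
    ⊝_   : Expr → Expr

  infixl 6 _⊕_ _⊖_
  infixl 7 _⊗_
  infix 8 ⊝_
  infix 4 _≈X_

  _⊖_ : Expr → Expr → Expr
  p ⊖ q = p ⊕ (⊝ q)

  𝟘 𝟙 : Expr
  𝟘 = con 0#
  𝟙 = con 1#

  data _≈X_ : Expr → Expr → Set (c ⊔ ℓ) where
    ≈refl  : ∀ {p} → p ≈X p
    ≈sym   : ∀ {p q} → p ≈X q → q ≈X p
    ≈trans : ∀ {p q r} → p ≈X q → q ≈X r → p ≈X r
    ⊕-cong : ∀ {p p′ q q′} → p ≈X p′ → q ≈X q′ → p ⊕ q ≈X p′ ⊕ q′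
    ⊗-cong : ∀ {p p′ q q′} → p ≈X p′ → q ≈X q′ → p ⊗ q ≈X p′ ⊗ q′
    ⊝-cong : ∀ {p p′} → p ≈X p′ → ⊝ p ≈X ⊝ p′
    ⊕-assoc : ∀ p q r → (p ⊕ q) ⊕ r ≈X p ⊕ (q ⊕ r)
    ⊕-comm  : ∀ p q → p ⊕ q ≈X q ⊕ p
    ⊕-identityˡ : ∀ p → 𝟘 ⊕ p ≈X p
    ⊝-inverseˡ  : ∀ p → (⊝ p) ⊕ p ≈X 𝟘
    ⊗-assoc : ∀ p q r → (p ⊗ q) ⊗ r ≈X p ⊗ (q ⊗ r)
    ⊗-comm  : ∀ p q → p ⊗ q ≈X q ⊗ p
    ⊗-identityˡ : ∀ p → 𝟙 ⊗ p ≈X p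
    distribˡ : ∀ p q r → p ⊗ (q ⊕ r) ≈X (p ⊗ q) ⊕ (p ⊗ r)
    con-cong : ∀ {a b} → a ≈K b → con a ≈X con b
    con-+    : ∀ a b → con (a + b) ≈X con a ⊕ con b
    con-*    : ∀ a b → con (a * b) ≈X con a ⊗ con b
    con--    : ∀ a → con (- a) ≈X ⊝ con a

  -- x_{i,j} for every pair (i,j);  x_{i,j} = -β - x_{j,i}  for j < i.
  -- (The value on the diagonal i = j is irrelevant and never used.)
  x : (β : K) → Fin n → Fin n → Expr
  x β i j with <-cmp i j
  ... | tri< i<j _ _ = var (v i j i<j)
  ... | tri≈ _ _ _   = 𝟘
  ... | tri> _ _ j<i = con (- β) ⊖ var (v j i j<i)

  gen : (β α : K) {i j k : Fin n} → i < j → j < k → i < k → Expr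
  gen β α {i} {j} {k} i<j j<k i<k =
    (var (v i j i<j) ⊗ var (v j k j<k))
      ⊖ (var (v i k i<k) ⊗ (var (v i j i<j) ⊕ var (v j k j<k) ⊕ con β))
      ⊖ con α

  data InJ (β α : K) : Expr → Set (c ⊔ ℓ) where
    J-gen  : ∀ {i j k} (i<j : i < j) (j<k : j < k) (i<k : i < k) →
             InJ β α (gen β α i<j j<k i<k)
    J-zero : InJ β α 𝟘
    J-add  : ∀ {p q} → InJ β α p → InJ β α q → InJ β α (p ⊕ q)
    J-mul  : ∀ r {p} → InJ β α p → InJ β α (r ⊗ p)
    J-resp : ∀ {p q} → p ≈X q → InJ β α p → InJ β α q

  -- Note: in the stdlib, (τ ∘ₚ σ) ⟨$⟩ʳ i = σ ⟨$⟩ʳ (τ ⟨$⟩ʳ i), i.e. τ ∘ₚ σ is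
  -- the usual product στ.
  record IsSnAction (β : K) (act : Permutation′ n → Expr → Expr) : Set (c ⊔ ℓ) where
    field
      act-cong : ∀ σ {p q} → p ≈X q → act σ p ≈X act σ q
      act-con  : ∀ σ a → act σ (con a) ≈X con a
      act-⊕    : ∀ σ p q → act σ (p ⊕ q) ≈X act σ p ⊕ act σ q
      act-⊗    : ∀ σ p q → act σ (p ⊗ q) ≈X act σ p ⊗ act σ q
      act-id   : ∀ p → act id p ≈X p
      act-comp : ∀ σ τ p → act (τ ∘ₚ σ) p ≈X act σ (act τ p)
      act-x    : ∀ σ (i j : Fin n) → i ≢ j →
                 act σ (x β i j) ≈X x β (σ ⟨$⟩ʳ i) (σ ⟨$⟩ʳ j)

-- X is free on the x_{i,j} with i < j, so σ acts as the substitution x_{i,j} ↦ x_{σ(i),σ(j)}, and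
-- any algebra homomorphism is determined by its values on these generators; the convention
-- x_{j,i} = −β − x_{i,j} makes σ · x_{i,j} = x_{σ(i),σ(j)} hold for i > j as well.
-- For J, write ρ(a,b,d) = x_{ab} x_{bd} − x_{ad}(x_{ab} + x_{bd} + β) − α for arbitrary indices.
-- Substituting x_{ba} = −β − x_{ab} (resp. x_{db} = −β − x_{bd}) turns ρ(b,a,d) (resp. ρ(a,d,b))
-- into ρ(a,b,d) by a ring identity, so ρ is invariant under all permutations of a triple of
-- distinct indices; hence σ maps each generator ρ(i,j,k), i < j < k, into J.
module Submission where

open import Defs
open import Level using (Level; 0ℓ; _⊔_)
open import Algebra.Bundles using (CommutativeRing; RawRing)
open import Algebra.Structures using (IsCommutativeRing)
open import Data.Nat as ℕ using (ℕ; _≤_)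
open import Data.Product using (Σ-syntax; _×_; _,_)
open import Data.Fin using (Fin; _<_)
open import Data.Fin.Properties using (<-cmp; <-irrelevant; <⇒≢; <-trans)
open import Data.Fin.Permutation using (Permutation′; _⟨$⟩ʳ_; id; _∘ₚ_)
open import Data.Maybe using (Maybe; just; nothing)
open import Data.Empty using (⊥-elim)
open import Function using (_∘_; Injection)
open import Function.Properties.Inverse using (↔⇒↣)
open import Relation.Nullary using (yes; no)
open import Relation.Binary.Definitions using (Tri; tri<; tri≈; tri>)
open import Relation.Binary.PropositionalEquality as ≡ using (_≡_; _≢_; refl)
open import Algebra.Solver.Ring.AlmostCommutativeRing
  using (fromCommutativeRing; _-Raw-AlmostCommutative⟶_)

module IntegerCoefficientSolver {a ℓ} (R : CommutativeRing a ℓ) where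
  open CommutativeRing R
  open import Algebra.Properties.Ring ring
    using (-‿+-comm; [y-z]x≈yx-zx; x[y-z]≈xy-xz; ⁻¹-anti-homo‿-; x∙y⁻¹≈ε⇒x≈y; -0#≈0#)
  open import Algebra.Properties.CommutativeSemigroup +-commutativeSemigroup using (interchange)
  open import Algebra.Properties.Semiring.Mult semiring
    using (×-homo-+; ×1-homo-*; ×-homo-1) renaming (_×_ to _×ₙ_)
  open import Relation.Binary.Reasoning.Setoid setoid

  -- The ring solver needs coefficients with decidable equality mapping into R; integers do
  -- for every R. The pair (m , k) stands for m − k and is never normalised, since the solver
  -- only compares interpretations in R.
  differences : RawRing 0ℓ 0ℓ
  differences = record
    { Carrier = ℕ × ℕ
    ; _≈_ = _≡_
    ; _+_ = λ { (m , k) (m′ , k′) → (m ℕ.+ m′ , k ℕ.+ k′) }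
    ; _*_ = λ { (m , k) (m′ , k′) → (m ℕ.* m′ ℕ.+ k ℕ.* k′ , m ℕ.* k′ ℕ.+ k ℕ.* m′) }
    ; -_ = λ { (m , k) → (k , m) }
    ; 0# = (0 , 0)
    ; 1# = (1 , 0)
    }

  ⟨_⟩ : ℕ → Carrier
  ⟨ m ⟩ = m ×ₙ 1#

  ⟦_⟧ : ℕ × ℕ → Carrier
  ⟦ m , k ⟧ = ⟨ m ⟩ - ⟨ k ⟩

  -‿+-interchange : ∀ x y z w → (x - y) + (z - w) ≈ (x + z) - (y + w)
  -‿+-interchange x y z w = begin
    (x - y) + (z - w)     ≈⟨ interchange x (- y) z (- w) ⟩
    (x + z) + (- y + - w) ≈⟨ +-congˡ (-‿+-comm y w) ⟩
    (x + z) - (y + w)     ∎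

  -‿*-expand : ∀ x y z w → (x - y) * (z - w) ≈ (x * z + y * w) - (x * w + y * z)
  -‿*-expand x y z w = begin
    (x - y) * (z - w)                 ≈⟨ [y-z]x≈yx-zx (z - w) x y ⟩
    x * (z - w) - y * (z - w)         ≈⟨ +-cong (x[y-z]≈xy-xz x z w) (-‿cong (x[y-z]≈xy-xz y z w)) ⟩
    (x * z - x * w) - (y * z - y * w) ≈⟨ +-congˡ (⁻¹-anti-homo‿- (y * z) (y * w)) ⟩
    (x * z - x * w) + (y * w - y * z) ≈⟨ -‿+-interchange (x * z) (x * w) (y * w) (y * z) ⟩
    (x * z + y * w) - (x * w + y * z) ∎

  -‿cross : ∀ x y z w → x + w ≈ z + y → x - y ≈ z - w
  -‿cross x y z w x+w≈z+y = x∙y⁻¹≈ε⇒x≈y (x - y) (z - w) (begin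
    (x - y) - (z - w) ≈⟨ +-congˡ (⁻¹-anti-homo‿- z w) ⟩
    (x - y) + (w - z) ≈⟨ -‿+-interchange x y w z ⟩
    (x + w) - (y + z) ≈⟨ +-cong x+w≈z+y (-‿cong (+-comm y z)) ⟩
    (z + y) - (z + y) ≈⟨ -‿inverseʳ (z + y) ⟩
    0#                ∎)

  ⟨⟩-homo-+ : ∀ m k → ⟨ m ℕ.+ k ⟩ ≈ ⟨ m ⟩ + ⟨ k ⟩
  ⟨⟩-homo-+ = ×-homo-+ 1#

  ⟨⟩-homo-+* : ∀ m k m′ k′ → ⟨ m ℕ.* m′ ℕ.+ k ℕ.* k′ ⟩ ≈ ⟨ m ⟩ * ⟨ m′ ⟩ + ⟨ k ⟩ * ⟨ k′ ⟩
  ⟨⟩-homo-+* m k m′ k′ =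
    trans (⟨⟩-homo-+ (m ℕ.* m′) (k ℕ.* k′)) (+-cong (×1-homo-* m m′) (×1-homo-* k k′))

  ⟦⟧-homomorphism : differences -Raw-AlmostCommutative⟶ fromCommutativeRing R
  ⟦⟧-homomorphism = record
    { ⟦_⟧ = ⟦_⟧
    ; +-homo = λ { (m , k) (m′ , k′) →
        trans (+-cong (⟨⟩-homo-+ m m′) (-‿cong (⟨⟩-homo-+ k k′)))
              (sym (-‿+-interchange ⟨ m ⟩ ⟨ k ⟩ ⟨ m′ ⟩ ⟨ k′ ⟩)) }
    ; *-homo = λ { (m , k) (m′ , k′) →
        trans (+-cong (⟨⟩-homo-+* m k m′ k′) (-‿cong (⟨⟩-homo-+* m k k′ m′)))
              (sym (-‿*-expand ⟨ m ⟩ ⟨ k ⟩ ⟨ m′ ⟩ ⟨ k′ ⟩)) }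
    ; -‿homo = λ { (m , k) → sym (⁻¹-anti-homo‿- ⟨ m ⟩ ⟨ k ⟩) }
    ; 0-homo = -‿inverseʳ 0#
    ; 1-homo = trans (+-cong (×-homo-1 1#) -0#≈0#) (+-identityʳ 1#)
    }

  ⟦⟧-equal? : ∀ p q → Maybe (⟦ p ⟧ ≈ ⟦ q ⟧)
  ⟦⟧-equal? (m , k) (m′ , k′) with m ℕ.+ k′ ℕ.≟ m′ ℕ.+ k
  ... | yes m+k′≡m′+k = just (-‿cross ⟨ m ⟩ ⟨ k ⟩ ⟨ m′ ⟩ ⟨ k′ ⟩ (begin
    ⟨ m ⟩ + ⟨ k′ ⟩ ≈⟨ ⟨⟩-homo-+ m k′ ⟨
    ⟨ m ℕ.+ k′ ⟩   ≡⟨ ≡.cong ⟨_⟩ m+k′≡m′+k ⟩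
    ⟨ m′ ℕ.+ k ⟩   ≈⟨ ⟨⟩-homo-+ m′ k ⟩
    ⟨ m′ ⟩ + ⟨ k ⟩ ∎))
  ... | no _ = nothing

  open import Algebra.Solver.Ring differences (fromCommutativeRing R) ⟦⟧-homomorphism ⟦⟧-equal?
    public using (solve; _:=_; _:+_; _:*_; _:-_; :-_)

module DefiningRelation {a ℓ} (R : CommutativeRing a ℓ) (β : CommutativeRing.Carrier R) where
  open CommutativeRing R renaming (refl to ≈-refl)
  open IntegerCoefficientSolver R

  -- The value of x_{ji} in terms of x_{ij} = u.
  flip : Carrier → Carrier
  flip u = - β - u

  flip-involutive : ∀ u → flip (flip u) ≈ u
  flip-involutive u = solve 2 (λ u b → :- b :- (:- b :- u) := u) ≈-refl u β

  -- The generator of J for the triple (i, j, k), with u = x_{ij}, w = x_{jk}, t = x_{ik}.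
  relation : Carrier → Carrier → Carrier → Carrier → Carrier
  relation α u w t = u * w - t * (u + w + β) - α

  relation-cong : ∀ α {u u′ w w′ t t′} → u ≈ u′ → w ≈ w′ → t ≈ t′ →
                  relation α u w t ≈ relation α u′ w′ t′
  relation-cong α u≈u′ w≈w′ t≈t′ =
    +-congʳ (+-cong (*-cong u≈u′ w≈w′) (-‿cong (*-cong t≈t′ (+-congʳ (+-cong u≈u′ w≈w′)))))

  relation-swap₁₂ : ∀ α u w t → relation α (flip u) t w ≈ relation α u w t
  relation-swap₁₂ α u w t = solve 5
    (λ u w t b c → ((:- b :- u) :* t :- w :* ((:- b :- u) :+ t :+ b) :- c)
                := (u :* w :- t :* (u :+ w :+ b) :- c))
    ≈-refl u w t β α

  relation-swap₂₃ : ∀ α u w t → relation α t (flip w) u ≈ relation α u w t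
  relation-swap₂₃ α u w t = solve 5
    (λ u w t b c → (t :* (:- b :- w) :- u :* (t :+ (:- b :- w) :+ b) :- c)
                := (u :* w :- t :* (u :+ w :+ b) :- c))
    ≈-refl u w t β α

module FreeAlgebra {c ℓ} (R : CommutativeRing c ℓ) (n : ℕ) where
  open Poly R n
  open CommutativeRing R using (0#)

  isCommutativeRing : IsCommutativeRing _≈X_ _⊕_ _⊗_ ⊝_ 𝟘 𝟙
  isCommutativeRing = record
    { isRing = record
      { +-isAbelianGroup = record
        { isGroup = record
          { isMonoid = record
            { isSemigroup = record
              { isMagma = record
                { isEquivalence = record { refl = ≈refl ; sym = ≈sym ; trans = ≈trans }
                ; ∙-cong = ⊕-cong }
              ; assoc = ⊕-assoc }
            ; identity = ⊕-identityˡ , λ p → ≈trans (⊕-comm p 𝟘) (⊕-identityˡ p) }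
          ; inverse = ⊝-inverseˡ , λ p → ≈trans (⊕-comm p (⊝ p)) (⊝-inverseˡ p)
          ; ⁻¹-cong = ⊝-cong }
        ; comm = ⊕-comm }
      ; *-cong = ⊗-cong
      ; *-assoc = ⊗-assoc
      ; *-identity = ⊗-identityˡ , λ p → ≈trans (⊗-comm p 𝟙) (⊗-identityˡ p)
      ; distrib = distribˡ , λ p q r →
          ≈trans (⊗-comm (q ⊕ r) p) (≈trans (distribˡ p q r) (⊕-cong (⊗-comm p q) (⊗-comm p r))) }
    ; *-comm = ⊗-comm }

  commutativeRing : CommutativeRing c (c ⊔ ℓ)
  commutativeRing = record { isCommutativeRing = isCommutativeRing }

  open import Algebra.Properties.Ring (CommutativeRing.ring commutativeRing)
    using (+-inverseˡ-unique)

  eval : (Var → Expr) → Expr → Expr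
  eval s (con a) = con a
  eval s (var w) = s w
  eval s (p ⊕ q) = eval s p ⊕ eval s q
  eval s (p ⊗ q) = eval s p ⊗ eval s q
  eval s (⊝ p)   = ⊝ eval s p

  eval-cong : ∀ s {p q} → p ≈X q → eval s p ≈X eval s q
  eval-cong s ≈refl              = ≈refl
  eval-cong s (≈sym e)           = ≈sym (eval-cong s e)
  eval-cong s (≈trans e e′)      = ≈trans (eval-cong s e) (eval-cong s e′)
  eval-cong s (⊕-cong e e′)      = ⊕-cong (eval-cong s e) (eval-cong s e′)
  eval-cong s (⊗-cong e e′)      = ⊗-cong (eval-cong s e) (eval-cong s e′)
  eval-cong s (⊝-cong e)         = ⊝-cong (eval-cong s e)
  eval-cong s (⊕-assoc p q r)    = ⊕-assoc _ _ _
  eval-cong s (⊕-comm p q)       = ⊕-comm _ _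
  eval-cong s (⊕-identityˡ p)    = ⊕-identityˡ _
  eval-cong s (⊝-inverseˡ p)     = ⊝-inverseˡ _
  eval-cong s (⊗-assoc p q r)    = ⊗-assoc _ _ _
  eval-cong s (⊗-comm p q)       = ⊗-comm _ _
  eval-cong s (⊗-identityˡ p)    = ⊗-identityˡ _
  eval-cong s (distribˡ p q r)   = distribˡ _ _ _
  eval-cong s (con-cong e)       = con-cong e
  eval-cong s (con-+ a b)        = con-+ a b
  eval-cong s (con-* a b)        = con-* a b
  eval-cong s (con-- a)          = con-- a

  eval-congˡ : ∀ {s t} → (∀ w → s w ≈X t w) → ∀ p → eval s p ≈X eval t p
  eval-congˡ s≈t (con a) = ≈refl
  eval-congˡ s≈t (var w) = s≈t w
  eval-congˡ s≈t (p ⊕ q) = ⊕-cong (eval-congˡ s≈t p) (eval-congˡ s≈t q)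
  eval-congˡ s≈t (p ⊗ q) = ⊗-cong (eval-congˡ s≈t p) (eval-congˡ s≈t q)
  eval-congˡ s≈t (⊝ p)   = ⊝-cong (eval-congˡ s≈t p)

  eval-var : ∀ p → eval var p ≈X p
  eval-var (con a) = ≈refl
  eval-var (var w) = ≈refl
  eval-var (p ⊕ q) = ⊕-cong (eval-var p) (eval-var q)
  eval-var (p ⊗ q) = ⊗-cong (eval-var p) (eval-var q)
  eval-var (⊝ p)   = ⊝-cong (eval-var p)

  record IsAlgebraHomomorphism (f : Expr → Expr) : Set (c ⊔ ℓ) where
    field
      cong     : ∀ {p q} → p ≈X q → f p ≈X f q
      con-homo : ∀ a → f (con a) ≈X con a
      ⊕-homo   : ∀ p q → f (p ⊕ q) ≈X f p ⊕ f q
      ⊗-homo   : ∀ p q → f (p ⊗ q) ≈X f p ⊗ f q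

    ⊝-homo : ∀ p → f (⊝ p) ≈X ⊝ f p
    ⊝-homo p = +-inverseˡ-unique (f (⊝ p)) (f p)
      (≈trans (≈sym (⊕-homo (⊝ p) p)) (≈trans (cong (⊝-inverseˡ p)) (con-homo 0#)))

  eval-isAlgebraHomomorphism : ∀ s → IsAlgebraHomomorphism (eval s)
  eval-isAlgebraHomomorphism s = record
    { cong = eval-cong s
    ; con-homo = λ _ → ≈refl
    ; ⊕-homo = λ _ _ → ≈refl
    ; ⊗-homo = λ _ _ → ≈refl
    }

  ∘-isAlgebraHomomorphism : ∀ {f g} → IsAlgebraHomomorphism f → IsAlgebraHomomorphism g →
                            IsAlgebraHomomorphism (f ∘ g)
  ∘-isAlgebraHomomorphism {f} {g} F G = record
    { cong = F.cong ∘ G.cong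
    ; con-homo = λ a → ≈trans (F.cong (G.con-homo a)) (F.con-homo a)
    ; ⊕-homo = λ p q → ≈trans (F.cong (G.⊕-homo p q)) (F.⊕-homo (g p) (g q))
    ; ⊗-homo = λ p q → ≈trans (F.cong (G.⊗-homo p q)) (F.⊗-homo (g p) (g q))
    }
    where
    module F = IsAlgebraHomomorphism F
    module G = IsAlgebraHomomorphism G

  module _ {f : Expr → Expr} (F : IsAlgebraHomomorphism f) where
    open IsAlgebraHomomorphism F

    homomorphism≈eval : ∀ p → f p ≈X eval (f ∘ var) p
    homomorphism≈eval (con a) = con-homo a
    homomorphism≈eval (var w) = ≈refl
    homomorphism≈eval (p ⊕ q) =
      ≈trans (⊕-homo p q) (⊕-cong (homomorphism≈eval p) (homomorphism≈eval q))
    homomorphism≈eval (p ⊗ q) =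
      ≈trans (⊗-homo p q) (⊗-cong (homomorphism≈eval p) (homomorphism≈eval q))
    homomorphism≈eval (⊝ p) = ≈trans (⊝-homo p) (⊝-cong (homomorphism≈eval p))

σ-preserves-≢ : ∀ {n} (σ : Permutation′ n) {i j} → i ≢ j → σ ⟨$⟩ʳ i ≢ σ ⟨$⟩ʳ j
σ-preserves-≢ σ i≢j = i≢j ∘ Injection.injective (↔⇒↣ σ)

module Action {c ℓ} (R : CommutativeRing c ℓ) (n : ℕ) (β : CommutativeRing.Carrier R) where
  open Poly R n
  open FreeAlgebra R n
  open CommutativeRing R using (-_)
  open DefiningRelation commutativeRing (con β)

  ≡⇒≈X : ∀ {p q} → p ≡ q → p ≈X q
  ≡⇒≈X refl = ≈refl

  x-< : ∀ {i j} (i<j : i < j) → x β i j ≡ var (v i j i<j)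
  x-< {i} {j} i<j with <-cmp i j
  ... | tri< i<j′ _ _ = ≡.cong (var ∘ v i j) (<-irrelevant i<j′ i<j)
  ... | tri≈ i≮j _ _ = ⊥-elim (i≮j i<j)
  ... | tri> i≮j _ _ = ⊥-elim (i≮j i<j)

  x-> : ∀ {i j} (j<i : j < i) → x β i j ≡ con (- β) ⊖ var (v j i j<i)
  x-> {i} {j} j<i with <-cmp i j
  ... | tri< _ _ j≮i = ⊥-elim (j≮i j<i)
  ... | tri≈ _ _ j≮i = ⊥-elim (j≮i j<i)
  ... | tri> _ _ j<i′ = ≡.cong (λ j<i → con (- β) ⊖ var (v j i j<i)) (<-irrelevant j<i′ j<i)

  x-antisym : ∀ {i j} → i ≢ j → x β i j ≈X flip (x β j i)
  x-antisym {i} {j} i≢j with <-cmp i j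
  ... | tri< i<j _ _ rewrite x-> i<j =
    ≈trans (≈sym (flip-involutive (var (v i j i<j))))
           (⊕-cong ≈refl (⊝-cong (⊕-cong (≈sym (con-- β)) ≈refl)))
  ... | tri≈ _ i≡j _ = ⊥-elim (i≢j i≡j)
  ... | tri> _ _ j<i rewrite x-< j<i = ⊕-cong (con-- β) ≈refl

  permuteVar : Permutation′ n → Var → Expr
  permuteVar σ (v i j _) = x β (σ ⟨$⟩ʳ i) (σ ⟨$⟩ʳ j)

  act : Permutation′ n → Expr → Expr
  act σ = eval (permuteVar σ)

  act-x : ∀ σ i j → i ≢ j → act σ (x β i j) ≈X x β (σ ⟨$⟩ʳ i) (σ ⟨$⟩ʳ j)
  act-x σ i j i≢j with <-cmp i j
  ... | tri< _ _ _ = ≈refl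
  ... | tri≈ _ i≡j _ = ⊥-elim (i≢j i≡j)
  ... | tri> _ _ _ =
    ≈trans (⊕-cong (con-- β) ≈refl) (≈sym (x-antisym (σ-preserves-≢ σ i≢j)))

  act-id : ∀ p → act id p ≈X p
  act-id p = ≈trans (eval-congˡ (λ { (v i j i<j) → ≡⇒≈X (x-< i<j) }) p) (eval-var p)

  act-comp : ∀ σ τ p → act (τ ∘ₚ σ) p ≈X act σ (act τ p)
  act-comp σ τ p = ≈trans
    (eval-congˡ (λ { (v i j i<j) → ≈sym (act-x σ _ _ (σ-preserves-≢ τ (<⇒≢ i<j))) }) p)
    (≈sym (homomorphism≈eval
      (∘-isAlgebraHomomorphism (eval-isAlgebraHomomorphism _) (eval-isAlgebraHomomorphism _)) p))

  act-isSnAction : IsSnAction β act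
  act-isSnAction = record
    { act-cong = λ σ → eval-cong (permuteVar σ)
    ; act-con = λ _ _ → ≈refl
    ; act-⊕ = λ _ _ _ → ≈refl
    ; act-⊗ = λ _ _ _ → ≈refl
    ; act-id = act-id
    ; act-comp = act-comp
    ; act-x = act-x
    }

  act-unique : ∀ act′ → IsSnAction β act′ → ∀ σ p → act′ σ p ≈X act σ p
  act-unique act′ act′-isSnAction σ p =
    ≈trans (homomorphism≈eval act′σ-isAlgebraHomomorphism p) (eval-congˡ act′σ-on-var p)
    where
    module S = IsSnAction act′-isSnAction

    act′σ-isAlgebraHomomorphism : IsAlgebraHomomorphism (act′ σ)
    act′σ-isAlgebraHomomorphism = record
      { cong = S.act-cong σ
      ; con-homo = S.act-con σ
      ; ⊕-homo = S.act-⊕ σ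
      ; ⊗-homo = S.act-⊗ σ
      }

    act′σ-on-var : ∀ w → act′ σ (var w) ≈X permuteVar σ w
    act′σ-on-var (v i j i<j) = ≈trans (S.act-cong σ (≈sym (≡⇒≈X (x-< i<j)))) (S.act-x σ i j (<⇒≢ i<j))

  module _ (α : CommutativeRing.Carrier R) where

    relationAt : Fin n → Fin n → Fin n → Expr
    relationAt a b d = relation (con α) (x β a b) (x β b d) (x β a d)

    relationAt-swap₁₂ : ∀ {a b} d → a ≢ b → relationAt b a d ≈X relationAt a b d
    relationAt-swap₁₂ d a≢b = ≈trans
      (relation-cong (con α) (x-antisym (a≢b ∘ ≡.sym)) ≈refl ≈refl)
      (relation-swap₁₂ (con α) _ _ _)

    relationAt-swap₂₃ : ∀ a {b d} → b ≢ d → relationAt a d b ≈X relationAt a b d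
    relationAt-swap₂₃ a b≢d = ≈trans
      (relation-cong (con α) ≈refl (x-antisym (b≢d ∘ ≡.sym)) ≈refl)
      (relation-swap₂₃ (con α) _ _ _)

    relationAt-sorted∈J : ∀ {a b d} → a < b → b < d → InJ β α (relationAt a b d)
    relationAt-sorted∈J a<b b<d
      rewrite x-< a<b | x-< b<d | x-< (<-trans a<b b<d) = J-gen a<b b<d (<-trans a<b b<d)

    relationAt∈J : ∀ {a b d} → a ≢ b → b ≢ d → a ≢ d → InJ β α (relationAt a b d)
    relationAt∈J {a} {b} {d} a≢b b≢d a≢d = sort (<-cmp a b) (<-cmp b d) (<-cmp a d)
      where
      sort : Tri (a < b) (a ≡ b) (b < a) → Tri (b < d) (b ≡ d) (d < b) → Tri (a < d) (a ≡ d) (d < a) →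
             InJ β α (relationAt a b d)
      sort (tri≈ _ a≡b _) _ _ = ⊥-elim (a≢b a≡b)
      sort _ (tri≈ _ b≡d _) _ = ⊥-elim (b≢d b≡d)
      sort _ _ (tri≈ _ a≡d _) = ⊥-elim (a≢d a≡d)
      sort (tri< a<b _ _) (tri< b<d _ _) _ = relationAt-sorted∈J a<b b<d
      sort (tri< _ _ _) (tri> _ _ d<b) (tri< a<d _ _) =
        J-resp (relationAt-swap₂₃ a b≢d) (relationAt-sorted∈J a<d d<b)
      sort (tri< a<b _ _) (tri> _ _ _) (tri> _ _ d<a) =
        J-resp (≈trans (relationAt-swap₁₂ b a≢d) (relationAt-swap₂₃ a b≢d))
               (relationAt-sorted∈J d<a a<b)
      sort (tri> _ _ b<a) (tri< _ _ _) (tri< a<d _ _) =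
        J-resp (relationAt-swap₁₂ d a≢b) (relationAt-sorted∈J b<a a<d)
      sort (tri> _ _ _) (tri< b<d _ _) (tri> _ _ d<a) =
        J-resp (≈trans (relationAt-swap₂₃ b a≢d) (relationAt-swap₁₂ d a≢b))
               (relationAt-sorted∈J b<d d<a)
      sort (tri> _ _ b<a) (tri> _ _ d<b) _ =
        J-resp (≈trans (relationAt-swap₁₂ a b≢d)
                 (≈trans (relationAt-swap₂₃ b a≢d) (relationAt-swap₁₂ d a≢b)))
               (relationAt-sorted∈J d<b b<a)

    act-preserves-J : ∀ σ p → InJ β α p → InJ β α (act σ p)
    act-preserves-J σ _ (J-gen i<j j<k i<k) = relationAt∈J
      (σ-preserves-≢ σ (<⇒≢ i<j)) (σ-preserves-≢ σ (<⇒≢ j<k)) (σ-preserves-≢ σ (<⇒≢ i<k))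
    act-preserves-J σ _ J-zero = J-zero
    act-preserves-J σ _ (J-add p∈J q∈J) = J-add (act-preserves-J σ _ p∈J) (act-preserves-J σ _ q∈J)
    act-preserves-J σ _ (J-mul r p∈J) = J-mul (act σ r) (act-preserves-J σ _ p∈J)
    act-preserves-J σ _ (J-resp p≈q p∈J) = J-resp (eval-cong (permuteVar σ) p≈q) (act-preserves-J σ _ p∈J)

proposition3p21 : ∀ {c ℓ : Level} (R : CommutativeRing c ℓ) (β α : CommutativeRing.Carrier R) (n : ℕ) → 1 ≤ n →
    let open Poly R n in
    Σ[ act ∈ (Permutation′ n → Expr → Expr) ]
    IsSnAction β act
    × (∀ (act′ : Permutation′ n → Expr → Expr) → IsSnAction β act′ →
    ∀ σ p → act′ σ p ≈X act σ p)
    × (∀ σ p → InJ β α p → InJ β α (act σ p))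
    × (∀ σ p q → InJ β α (p ⊖ q) → InJ β α (act σ p ⊖ act σ q))
proposition3p21 R β α n _ =
  act , act-isSnAction , act-unique , act-preserves-J α , λ σ p q → act-preserves-J α σ (p ⊖ q)
  where
  open Action R n β
  open Poly R n using (_⊖_)
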